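{- Let $k,\ell\ge1$, $\vec r\in\mathbb Z_{\ge1}^k$, $\vec s\in\mathbb Z_{\ge1}^\ell$, $\vec t\in\mathbb Z_{\ge1}^{k+\ell}$ with $|\vec r|+|\vec s|=|\vec t|$, and $(\varphi,\psi)\in I_{k,\ell}$. Write $c=c_{\vec r,\vec s}^{\vec t,(\varphi,\psi)}$. (1) Suppose $r_1\ge2$ and $s_1\ge2$. If $t_1\ge2$ then $c=c_{\vec r-\vec e_1,\vec s}^{\vec t-\vec e_1,(\varphi,\psi)}+c_{\vec r,\vec s-\vec e_1}^{\vec t-\vec e_1,(\varphi,\psi)}$. If $t_1=1$ then $c=0$. (2) Suppose $r_1=s_1=1$. If $\varphi(1)=1$ and $t_1=1$ then $c=c_{\vec r\,',\vec s}^{\vec t\,',(\check\varphi,\bar\psi)}$. If $\psi(1)=1$ and $t_1=1$ then $c=c_{\vec r,\vec s\,'}^{\vec t\,',(\bar\varphi,\check\psi)}$. If $t_1\ge2$ then $c=0$. (3) Suppose $r_1=1$ and $s_1\ge2$. If $\varphi(1)=1$ and $t_1=1$ then $c=c_{\vec r\,',\vec s}^{\vec t\,',(\check\varphi,\bar\psi)}$. If $\psi(1)=1$ and $t_1=1$ then $c=0$. If $t_1\ge2$ then $c=c_{\vec r,\vec s-\vec e_1}^{\vec t-\vec e_1,(\varphi,\psi)}$. Symmetrically, suppose $r_1\ge2$ and $s_1=1$: if $\psi(1)=1$ and $t_1=1$ then $c=c_{\vec r,\vec s\,'}^{\vec t\,',(\bar\varphi,\check\psi)}$; if $\varphi(1)=1$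 and $t_1=1$ then $c=0$; if $t_1\ge2$ then $c=c_{\vec r-\vec e_1,\vec s}^{\vec t-\vec e_1,(\varphi,\psi)}$.
   Context: For $m\ge0$, $[m]=\{1,\dots,m\}$ ($[0]=\emptyset$); $|\vec x|$ is the sum of entries; $\mathbb Z_{\ge1}^0$ consists of the single empty vector, of sum $0$. For integers $k,\ell\ge0$ not both zero, $I_{k,\ell}$ is the set of pairs $(\varphi,\psi)$ of order-preserving injective maps $\varphi:[k]\to[k+\ell]$, $\psi:[\ell]\to[k+\ell]$ with $\mathrm{im}\,\varphi\sqcup\mathrm{im}\,\psi=[k+\ell]$ (maps from $[0]$ are empty). For $\vec r\in\mathbb Z_{\ge1}^k$, $\vec s\in\mathbb Z_{\ge1}^\ell$, $\vec t\in\mathbb Z_{\ge1}^{k+\ell}$ with $|\vec t|=|\vec r|+|\vec s|$ and $(\varphi,\psi)\in I_{k,\ell}$: $h_i=r_j$ if $i=\varphi(j)$, $h_i=s_j$ if $i=\psi(j)$; $\varepsilon(i)=1$ if $i\in\mathrm{im}\,\varphi$, else $-1$; $c(i)=\binom{t_i-1}{h_i-1}$ if $i=1$ or ($i\ge2$ and $\varepsilon(i)=\varepsilon(i-1)$), and $c(i)=\binom{t_i-1}{\sum_{j\le i}t_j-\sum_{j\le i}h_j}$ if $i\ge2$ and $\varepsilon(i)\ne\varepsilon(i-1)$; for integers $a\ge0,b$, $\binom ab$ is the usual binomial coefficient when $0\le b\le a$ and $0$ otherwise; $c_{\vec r,\vec s}^{\vec t,(\varphi,\psi)}=\prod_{i=1}^{k+\ell}c(i)$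 (with the same definition when $k=0$ or $\ell=0$). $\vec e_1=(1,0,\dots,0)$ of the appropriate length. For $\vec x=(x_1,\dots,x_m)$, $\vec x\,'=(x_2,\dots,x_m)$ (empty if $m=1$). For a function $f$ on $[m]$: $\check f(x)=f(x+1)-1$ on $[m-1]$ (empty if $m=1$), $\bar f(x)=f(x)-1$ on $[m]$. -}

module Defs where

open import Data.Nat using (ℕ; zero; suc; _+_; _*_; _∸_; _≤_)
open import Data.Nat.Combinatorics using (_C_)
open import Data.Integer as ℤ using (ℤ; +_; -[1+_])
open import Data.Fin using (Fin; zero; suc; inject₁; toℕ; _≟_) renaming (_<_ to _<ᶠ_)
open import Data.Fin.Properties using (any?)
open import Data.Bool using (Bool; true; false; _∧_; not; if_then_else_)
open import Data.Bool.Properties renaming (_≟_ to _≟ᵇ_)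
open import Data.Product using (Σ; ∃; _×_; _,_)
open import Data.Sum using (_⊎_)
open import Relation.Binary.PropositionalEquality using (_≡_; _≢_)
open import Relation.Nullary using (Dec; yes; no; does)

-- Vectors in ℤ_{≥0}^m are functions Fin m → ℕ (index zero = first entry).
Vec' : ℕ → Set
Vec' m = Fin m → ℕ

vsum : ∀ {m} → Vec' m → ℕ
vsum {zero}  v = 0
vsum {suc m} v = v zero + vsum (λ i → v (suc i))

vprod : ∀ {m} → Vec' m → ℕ
vprod {zero}  v = 1
vprod {suc m} v = v zero * vprod (λ i → v (suc i))

Pos : ∀ {m} → Vec' m → Set
Pos v = ∀ i → 1 ≤ v i

minusE1 : ∀ {m} → Vec' (suc m) → Vec' (suc m)
minusE1 v zero    = v zero ∸ 1
minusE1 v (suc i) = v (suc i)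

tail' : ∀ {m} → Vec' (suc m) → Vec' m
tail' v i = v (suc i)

StrictMono : ∀ {k n} → (Fin k → Fin n) → Set
StrictMono f = ∀ a b → a <ᶠ b → f a <ᶠ f b

IsShuffle : ∀ {k ℓ} → (Fin k → Fin (k + ℓ)) → (Fin ℓ → Fin (k + ℓ)) → Set
IsShuffle φ ψ =
  StrictMono φ × StrictMono ψ ×
  (∀ a b → φ a ≢ ψ b) ×
  (∀ i → (∃ λ a → φ a ≡ i) ⊎ (∃ λ b → ψ b ≡ i))

IsCheck : ∀ {k n m} → (Fin (suc k) → Fin n) → (Fin k → Fin m) → Set
IsCheck f g = ∀ x → suc (toℕ (g x)) ≡ toℕ (f (suc x))

IsBar : ∀ {k n m} → (Fin k → Fin n) → (Fin k → Fin m) → Set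
IsBar f g = ∀ x → suc (toℕ (g x)) ≡ toℕ (f x)

-- binomial coefficient with integer lower index (0 outside 0 ≤ b ≤ a)
binom : ℕ → ℤ → ℕ
binom a (+ b)      = a C b
binom a -[1+ b ]   = 0

psum : ∀ {n} → Vec' n → Fin n → ℕ
psum v zero    = v zero
psum v (suc j) = v zero + psum (λ i → v (suc i)) j

module Coeff {k ℓ n : ℕ} (r : Vec' k) (s : Vec' ℓ) (t : Vec' n)
             (φ : Fin k → Fin n) (ψ : Fin ℓ → Fin n) where

  -- ε(i) = 1  ⇔  inIm i = true
  inIm : Fin n → Bool
  inIm i = does (any? (λ j → φ j ≟ i))

  h : Fin n → ℕ
  h i with any? (λ j → φ j ≟ i)
  ... | yes (j , _) = r j
  ... | no _ with any? (λ j → ψ j ≟ i)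
  ...   | yes (j , _) = s j
  ...   | no _ = 0

  sameCase : Fin n → ℕ
  sameCase i = binom (t i ∸ 1) (ℤ._-_ (+ h i) (+ 1))

  switchCase : Fin n → ℕ
  switchCase i = binom (t i ∸ 1) (ℤ._-_ (+ psum t i) (+ psum h i))

  cterm : Fin n → ℕ
  cterm zero    = sameCase zero
  cterm (suc j) with inIm (suc j) ≟ᵇ inIm (inject₁ j)
  ... | yes _ = sameCase (suc j)
  ... | no _  = switchCase (suc j)

  coeff : ℕ
  coeff = vprod cterm

-- c_{r,s}^{t,(φ,ψ)}  (the ambient length n is a parameter; the paper has n = k + ℓ)
c : ∀ {k ℓ n} → Vec' k → Vec' ℓ → Vec' n → (Fin k → Fin n) → (Fin ℓ → Fin n) → ℕ
c r s t φ ψ = Coeff.coeff r s t φ ψ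

-- Split c into its first factor (t₁-1 choose h₁-1) and the product over the remaining
-- positions; the latter depends on the first entry only through the offset t₁ - h₁ and the
-- label of position 1. Since the first factor equals (t₁-1 choose t₁-h₁), c is symmetric under
-- exchanging (r, φ) and (s, ψ), so we may assume φ(1) = 1. Subtracting e₁ from r and t keeps
-- the offset and gives the first factor (t₁-2 choose r₁-2). Subtracting e₁ from s and t gives
-- (t₁-2 choose r₁-1) and lowers the offset by one, which is compensated at the position of ψ(1),
-- whose switching factor only sees offset + t - h; Pascal's rule then gives (1). If s₁ = 1 and
-- t₁ > r₁, that switching factor is (t - 1 choose t - 1 + positive) = 0, which gives the
-- vanishing statements; the rest is evaluating (t₁-1 choose r₁-1) for small values.
module Submission where

open import Defs
open import Data.Bool using (Bool; true; false; not; _xor_)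
open import Data.Bool.Properties using (xor-same) renaming (_≟_ to _≟ᵇ_)
open import Data.Empty using (⊥-elim)
open import Data.Fin using (Fin; zero; suc; inject₁; toℕ; _≟_)
open import Data.Fin.Properties using (any?; toℕ-injective; suc-injective; 0≢1+n; <-cmp)
open import Data.Integer as ℤ using (ℤ; +_; _⊖_)
import Data.Integer.Properties as ℤₚ
open import Data.Integer.Tactic.RingSolver using (solve-∀)
open import Data.Nat
  using (ℕ; zero; suc; _+_; _*_; _∸_; _≤_; _<_; z≤n; s≤s; z<s; s<s; s<s⁻¹; _≤?_; _<?_; >-nonZero)
open import Data.Nat.Combinatorics using (_C_; k>n⇒nCk≡0; nCk≡nC[n∸k]; nCk+nC[k+1]≡[n+1]C[k+1])
open import Data.Nat.Properties
  using (≤-trans; ≤-refl; <-irrefl; <-asym; n≮0; ≰⇒>; ≮⇒≥; m≤m+n; m≤n+m; m<n+m; m<n⇒0<n∸m;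
         +-∸-assoc; +-comm; suc-pred; <⇒≤; +-identityʳ; *-identityˡ; *-zeroʳ; *-distribʳ-+; ∸-monoˡ-≤)
open import Data.Product using (∃; _×_; _,_; proj₁; proj₂)
open import Data.Sum using (_⊎_; inj₁; inj₂; swap)
open import Function using (_∘_)
open import Function.Definitions using (Injective)
open import Relation.Binary.Definitions using (tri<; tri≈; tri>)
open import Relation.Binary.PropositionalEquality
open import Relation.Nullary using (yes; no)

xor-not : ∀ x y → not x xor not y ≡ x xor y
xor-not true  true  = refl
xor-not true  false = refl
xor-not false true  = refl
xor-not false false = refl

xor-≢ : ∀ {x y} → x ≢ y → x xor y ≡ true
xor-≢ {true}  {true}  x≢y = ⊥-elim (x≢y refl)
xor-≢ {true}  {false} _   = refl
xor-≢ {false} {true}  _   = refl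
xor-≢ {false} {false} x≢y = ⊥-elim (x≢y refl)

not-xor-self : ∀ x → not x xor x ≡ true
not-xor-self true  = refl
not-xor-self false = refl

advance : ℤ → ℕ → ℕ → ℤ
advance d a x = d ℤ.+ + a ℤ.- + x

advance-+ : ∀ d a x b y → advance d (a + b) (x + y) ≡ advance (advance d a x) b y
advance-+ d a x b y rewrite ℤₚ.pos-+ a b | ℤₚ.pos-+ x y = ring d (+ a) (+ x) (+ b) (+ y)
  where
  ring : ∀ (d A X B Y : ℤ) → d ℤ.+ (A ℤ.+ B) ℤ.- (X ℤ.+ Y) ≡ d ℤ.+ A ℤ.- X ℤ.+ B ℤ.- Y
  ring = solve-∀

advance-pred : ∀ d a x → advance (d ℤ.- + 1) a x ≡ advance d a x ℤ.- + 1
advance-pred d a x = ring d (+ a) (+ x)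
  where
  ring : ∀ (d A X : ℤ) → d ℤ.- + 1 ℤ.+ A ℤ.- X ≡ d ℤ.+ A ℤ.- X ℤ.- + 1
  ring = solve-∀

advance-pred-suc : ∀ d a x → advance (d ℤ.- + 1) a x ≡ advance d a (suc x)
advance-pred-suc d a x rewrite ℤₚ.pos-+ 1 x = ring d (+ a) (+ x)
  where
  ring : ∀ (d A X : ℤ) → d ℤ.- + 1 ℤ.+ A ℤ.- X ≡ d ℤ.+ A ℤ.- (+ 1 ℤ.+ X)
  ring = solve-∀

advance-predˡ : ∀ d {a} x → 1 ≤ a → advance d (a ∸ 1) x ≡ advance d a x ℤ.- + 1
advance-predˡ d {suc a} x _ rewrite ℤₚ.pos-+ 1 a = ring d (+ a) (+ x)
  where
  ring : ∀ (d A X : ℤ) → d ℤ.+ A ℤ.- X ≡ d ℤ.+ (+ 1 ℤ.+ A) ℤ.- X ℤ.- + 1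
  ring = solve-∀

advance-pred-pred : ∀ d {a x} → 1 ≤ a → 1 ≤ x → advance d (a ∸ 1) (x ∸ 1) ≡ advance d a x
advance-pred-pred d {suc a} {suc x} _ _ rewrite ℤₚ.pos-+ 1 a | ℤₚ.pos-+ 1 x = ring d (+ a) (+ x)
  where
  ring : ∀ (d A X : ℤ) → d ℤ.+ A ℤ.- X ≡ d ℤ.+ (+ 1 ℤ.+ A) ℤ.- (+ 1 ℤ.+ X)
  ring = solve-∀

advance-nonneg : ∀ d {a x} → x ≤ a → advance (+ d) a x ≡ + (d + (a ∸ x))
advance-nonneg d {a} {x} x≤a = begin
  + (d + a) ℤ.- + x    ≡⟨ ℤₚ.m-n≡m⊖n (d + a) x ⟩
  (d + a) ⊖ x          ≡⟨ ℤₚ.⊖-≥ (≤-trans x≤a (m≤n+m a d)) ⟩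
  + (d + a ∸ x)        ≡⟨ cong +_ (+-∸-assoc d x≤a) ⟩
  + (d + (a ∸ x))      ∎
  where open ≡-Reasoning

sameBinom : ℕ → ℕ → ℕ
sameBinom a x = binom (a ∸ 1) (+ x ℤ.- + 1)

sameBinom-pascal : ∀ {a x} → 2 ≤ a → 2 ≤ x →
  sameBinom a x ≡ sameBinom (a ∸ 1) (x ∸ 1) + sameBinom (a ∸ 1) x
sameBinom-pascal {suc (suc a)} {suc (suc x)} (s≤s (s≤s _)) (s≤s (s≤s _)) = sym (nCk+nC[k+1]≡[n+1]C[k+1] a x)

sameBinom-vanish : ∀ {a x} → 1 ≤ a → a < x → sameBinom a x ≡ 0
sameBinom-vanish {suc a} {suc x} _ (s<s a<x) = k>n⇒nCk≡0 a<x

sameBinom-pred-vanish : ∀ {a x} → 2 ≤ a → a ≤ x → sameBinom (a ∸ 1) x ≡ 0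
sameBinom-pred-vanish (s≤s (s≤s _)) a≤x = sameBinom-vanish (s≤s z≤n) a≤x

binom-⊖-< : ∀ a {m n} → m < n → binom a (m ⊖ n) ≡ 0
binom-⊖-< a (s≤s m≤n) rewrite ℤₚ.⊖-< (s≤s m≤n) | +-∸-assoc 1 m≤n = refl

sameBinom-sym : ∀ {a x} → 1 ≤ a → 1 ≤ x → binom (a ∸ 1) (advance (+ 0) a x) ≡ sameBinom a x
sameBinom-sym {suc a} {suc x} _ _ with x ≤? a
... | yes x≤a = trans (cong (binom a) (trans (ℤₚ.m-n≡m⊖n (suc a) (suc x)) (ℤₚ.⊖-≥ (s≤s x≤a))))
                      (sym (nCk≡nC[n∸k] x≤a))
... | no x≰a  = trans (cong (binom a) (ℤₚ.m-n≡m⊖n (suc a) (suc x)))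
                      (trans (binom-⊖-< a (s<s (≰⇒> x≰a))) (sym (k>n⇒nCk≡0 (≰⇒> x≰a))))

factor : Bool → ℤ → ℕ → ℕ → ℕ
factor true  z a x = binom (a ∸ 1) z
factor false z a x = sameBinom a x

-- coeffFrom d b T H E is the product of the c-factors of a final segment (T, H, E) of the data
-- (t, h, ε), where d is the sum of t_j - h_j and b the label ε over the entries preceding it.
coeffFrom : ∀ {m} → ℤ → Bool → Vec' m → Vec' m → (Fin m → Bool) → ℕ
coeffFrom {zero}  d b T H E = 1
coeffFrom {suc m} d b T H E =
  factor (E zero xor b) (advance d (T zero) (H zero)) (T zero) (H zero)
  * coeffFrom (advance d (T zero) (H zero)) (E zero) (tail' T) (tail' H) (E ∘ suc)

coeffFrom-cong : ∀ {m} d b {T T' H H' : Vec' m} {E E' : Fin m → Bool} →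
  (∀ i → T i ≡ T' i) → (∀ i → H i ≡ H' i) → (∀ i → E i ≡ E' i) →
  coeffFrom d b T H E ≡ coeffFrom d b T' H' E'
coeffFrom-cong {zero}  d b eT eH eE = refl
coeffFrom-cong {suc m} d b {T' = T'} {H' = H'} {E' = E'} eT eH eE rewrite eT zero | eH zero | eE zero =
  cong (factor (E' zero xor b) (advance d (T' zero) (H' zero)) (T' zero) (H' zero) *_)
    (coeffFrom-cong _ _ (eT ∘ suc) (eH ∘ suc) (eE ∘ suc))

coeffFrom-not : ∀ {m} d b (T H : Vec' m) E → coeffFrom d (not b) T H (not ∘ E) ≡ coeffFrom d b T H E
coeffFrom-not {zero}  d b T H E = refl
coeffFrom-not {suc m} d b T H E rewrite xor-not (E zero) b =
  cong (factor (E zero xor b) (advance d (T zero) (H zero)) (T zero) (H zero) *_)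
    (coeffFrom-not _ (E zero) (tail' T) (tail' H) (E ∘ suc))

-- Before position p the factors do not see the offset, and at p the switching index d + T p - H p
-- is the same on both sides; from there on the offsets agree.
coeffFrom-lower : ∀ {m} d b (T H H' : Vec' m) E (p : Fin m) →
  (∀ i → toℕ i < toℕ p → E i ≡ b) → E p ≡ not b →
  H p ≡ suc (H' p) → (∀ i → i ≢ p → H' i ≡ H i) →
  coeffFrom (d ℤ.- + 1) b T H' E ≡ coeffFrom d b T H E
coeffFrom-lower {suc m} d b T H H' E zero _ switch Hp others
  rewrite switch | not-xor-self b | Hp | advance-pred-suc d (T zero) (H' zero) =
  cong (binom (T zero ∸ 1) (advance d (T zero) (suc (H' zero))) *_)
    (coeffFrom-cong _ _ (λ _ → refl) (λ i → others (suc i) (λ ())) (λ _ → refl))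
coeffFrom-lower {suc m} d b T H H' E (suc p) before switch Hp others
  rewrite before zero z<s | xor-same b | others zero (λ ()) | advance-pred d (T zero) (H zero) =
  cong (sameBinom (T zero) (H zero) *_)
    (coeffFrom-lower (advance d (T zero) (H zero)) b (tail' T) (tail' H) (tail' H') (E ∘ suc) p
      (λ i i<p → before (suc i) (s<s i<p)) switch Hp (λ i i≢p → others (suc i) (i≢p ∘ suc-injective)))

-- With a positive offset, the first label change at an entry with h = 1 contributes a zero factor;
-- before it, either some factor vanishes or the offset stays positive.
coeffFrom-vanish : ∀ {m n} b (T H : Vec' m) E (p : Fin m) → 1 ≤ n → Pos T →
  (∀ i → toℕ i < toℕ p → E i ≡ b) → E p ≡ not b → H p ≡ 1 → coeffFrom (+ n) b T H E ≡ 0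
coeffFrom-vanish {suc m} {n} b T H E zero n≥1 PT _ switch Hp
  rewrite switch | not-xor-self b | Hp | advance-nonneg n (PT zero) =
  cong (_* coeffFrom (+ (n + (T zero ∸ 1))) (not b) (tail' T) (tail' H) (E ∘ suc))
    (k>n⇒nCk≡0 (m<n+m (T zero ∸ 1) n≥1))
coeffFrom-vanish {suc m} {n} b T H E (suc p) n≥1 PT before switch Hp
  rewrite before zero z<s | xor-same b with H zero ≤? T zero
... | yes H≤T rewrite advance-nonneg n H≤T =
  trans (cong (sameBinom (T zero) (H zero) *_)
          (coeffFrom-vanish b (tail' T) (tail' H) (E ∘ suc) p (≤-trans n≥1 (m≤m+n n _)) (PT ∘ suc)
            (λ i i<p → before (suc i) (s<s i<p)) switch Hp))
        (*-zeroʳ (sameBinom (T zero) (H zero)))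
... | no H≰T =
  cong (_* coeffFrom (advance (+ n) (T zero) (H zero)) b (tail' T) (tail' H) (E ∘ suc))
    (sameBinom-vanish (PT zero) (≰⇒> H≰T))

vprod-cong : ∀ {m} {f g : Vec' m} → (∀ i → f i ≡ g i) → vprod f ≡ vprod g
vprod-cong {zero}  _   = refl
vprod-cong {suc m} f≗g = cong₂ _*_ (f≗g zero) (vprod-cong (f≗g ∘ suc))

laterFactors : ∀ {m} → ℤ → Vec' (suc m) → Vec' (suc m) → (Fin (suc m) → Bool) → Fin m → ℕ
laterFactors d t h e j =
  factor (e (suc j) xor e (inject₁ j)) (advance d (psum t (suc j)) (psum h (suc j))) (t (suc j)) (h (suc j))

vprod-laterFactors : ∀ {m} d (t h : Vec' (suc m)) e →
  vprod (laterFactors d t h e) ≡ coeffFrom (advance d (t zero) (h zero)) (e zero) (tail' t) (tail' h) (e ∘ suc)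
vprod-laterFactors {zero}  d t h e = refl
vprod-laterFactors {suc m} d t h e =
  cong₂ _*_ (cong (λ z → factor (e (suc zero) xor e zero) z (t (suc zero)) (h (suc zero)))
                  (advance-+ d (t zero) (h zero) (t (suc zero)) (h (suc zero))))
            (trans (vprod-cong shifted) (vprod-laterFactors d′ (tail' t) (tail' h) (e ∘ suc)))
  where
  d′ : ℤ
  d′ = advance d (t zero) (h zero)
  shifted : ∀ j → laterFactors d t h e (suc j) ≡ laterFactors d′ (tail' t) (tail' h) (e ∘ suc) j
  shifted j = cong (λ z → factor (e (suc (suc j)) xor e (suc (inject₁ j))) z (t (suc (suc j))) (h (suc (suc j))))
                   (advance-+ d (t zero) (h zero) (psum (tail' t) (suc j)) (psum (tail' h) (suc j)))

module _ {k ℓ m} (r : Vec' k) (s : Vec' ℓ) (t : Vec' (suc m))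
         (φ : Fin k → Fin (suc m)) (ψ : Fin ℓ → Fin (suc m)) where
  open Coeff r s t φ ψ

  private
    cterm≡laterFactors : ∀ j → cterm (suc j) ≡ laterFactors (+ 0) t h inIm j
    cterm≡laterFactors j with inIm (suc j) ≟ᵇ inIm (inject₁ j)
    ... | yes same rewrite same | xor-same (inIm (inject₁ j)) = refl
    ... | no differ rewrite xor-≢ differ = refl

  coeff-unfold : c r s t φ ψ ≡ sameBinom (t zero) (h zero) *
    coeffFrom (advance (+ 0) (t zero) (h zero)) (inIm zero) (tail' t) (tail' h) (inIm ∘ suc)
  coeff-unfold = cong (sameBinom (t zero) (h zero) *_)
    (trans (vprod-cong cterm≡laterFactors) (vprod-laterFactors (+ 0) t h inIm))

-- The first factor has no predecessor, and by symmetry of the binomial coefficient it may be read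
-- as a switching factor as well, so the initial label is arbitrary.
coeff≡coeffFrom : ∀ {k ℓ n} (r : Vec' k) (s : Vec' ℓ) (t : Vec' n) φ ψ →
  Pos t → Pos (Coeff.h r s t φ ψ) → ∀ b →
  c r s t φ ψ ≡ coeffFrom (+ 0) b t (Coeff.h r s t φ ψ) (Coeff.inIm r s t φ ψ)
coeff≡coeffFrom {n = zero}  r s t φ ψ _  _  _ = refl
coeff≡coeffFrom {n = suc m} r s t φ ψ Pt Ph b =
  trans (coeff-unfold r s t φ ψ)
        (cong (_* coeffFrom d (inIm zero) (tail' t) (tail' h) (inIm ∘ suc)) (first (inIm zero xor b)))
  where
  open Coeff r s t φ ψ using (h; inIm)
  d : ℤ
  d = advance (+ 0) (t zero) (h zero)
  first : ∀ e → sameBinom (t zero) (h zero) ≡ factor e d (t zero) (h zero)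
  first true  = sym (sameBinom-sym (Pt zero) (Ph zero))
  first false = refl

strictMono⇒injective : ∀ {k n} {f : Fin k → Fin n} → StrictMono f → Injective _≡_ _≡_ f
strictMono⇒injective {f = f} mono {a} {b} fa≡fb with <-cmp a b
... | tri< a<b _ _ = ⊥-elim (<-irrefl (cong toℕ fa≡fb) (mono a b a<b))
... | tri≈ _ a≡b _ = a≡b
... | tri> _ _ b<a = ⊥-elim (<-irrefl (cong toℕ (sym fa≡fb)) (mono b a b<a))

strictMono-suc≢zero : ∀ {k n} {f : Fin (suc k) → Fin (suc n)} → StrictMono f → ∀ a → f (suc a) ≢ zero
strictMono-suc≢zero {f = f} mono a eq = n≮0 (subst (λ i → toℕ (f zero) < toℕ i) eq (mono zero (suc a) z<s))

-- IsShuffle fixes the ambient length to k + ℓ; removing the first entry needs it arbitrary.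
record Shuffle {k ℓ n} (φ : Fin k → Fin n) (ψ : Fin ℓ → Fin n) : Set where
  field
    φ-mono   : StrictMono φ
    ψ-mono   : StrictMono ψ
    disjoint : ∀ a b → φ a ≢ ψ b
    cover    : ∀ i → (∃ λ a → φ a ≡ i) ⊎ (∃ λ b → ψ b ≡ i)

  φ-injective : Injective _≡_ _≡_ φ
  φ-injective = strictMono⇒injective φ-mono

  ψ-injective : Injective _≡_ _≡_ ψ
  ψ-injective = strictMono⇒injective ψ-mono

Shuffle-swap : ∀ {k ℓ n} {φ : Fin k → Fin n} {ψ : Fin ℓ → Fin n} → Shuffle φ ψ → Shuffle ψ φ
Shuffle-swap sh = record
  { φ-mono   = ψ-mono
  ; ψ-mono   = φ-mono
  ; disjoint = λ a b eq → disjoint b a (sym eq)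
  ; cover    = swap ∘ cover
  }
  where open Shuffle sh

IsShuffle⇒Shuffle : ∀ {k ℓ} {φ : Fin k → Fin (k + ℓ)} {ψ : Fin ℓ → Fin (k + ℓ)} →
  IsShuffle φ ψ → Shuffle φ ψ
IsShuffle⇒Shuffle (φ-mono , ψ-mono , disjoint , cover) = record
  { φ-mono = φ-mono ; ψ-mono = ψ-mono ; disjoint = disjoint ; cover = cover }

first-position : ∀ {k ℓ m} {φ : Fin (suc k) → Fin (suc m)} {ψ : Fin (suc ℓ) → Fin (suc m)} →
  Shuffle φ ψ → φ zero ≡ zero ⊎ ψ zero ≡ zero
first-position sh with Shuffle.cover sh zero
... | inj₁ (zero  , eq) = inj₁ eq
... | inj₁ (suc a , eq) = ⊥-elim (strictMono-suc≢zero (Shuffle.φ-mono sh) a eq)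
... | inj₂ (zero  , eq) = inj₂ eq
... | inj₂ (suc b , eq) = ⊥-elim (strictMono-suc≢zero (Shuffle.ψ-mono sh) b eq)

module Labels {k ℓ n} (r : Vec' k) (s : Vec' ℓ) (t : Vec' n)
              {φ : Fin k → Fin n} {ψ : Fin ℓ → Fin n} (sh : Shuffle φ ψ) where
  open Shuffle sh
  open Coeff r s t φ ψ using (h; inIm)

  h-φ : ∀ {a i} → φ a ≡ i → h i ≡ r a
  h-φ {a} {i} φa≡i with any? (λ j → φ j ≟ i)
  ... | yes (j , φj≡i) = cong r (φ-injective (trans φj≡i (sym φa≡i)))
  ... | no ∄j = ⊥-elim (∄j (a , φa≡i))

  inIm-φ : ∀ {a i} → φ a ≡ i → inIm i ≡ true
  inIm-φ {a} {i} φa≡i with any? (λ j → φ j ≟ i)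
  ... | yes _ = refl
  ... | no ∄j = ⊥-elim (∄j (a , φa≡i))

  h-ψ : ∀ {b i} → ψ b ≡ i → h i ≡ s b
  h-ψ {b} {i} ψb≡i with any? (λ j → φ j ≟ i)
  ... | yes (j , φj≡i) = ⊥-elim (disjoint j b (trans φj≡i (sym ψb≡i)))
  ... | no _ with any? (λ j → ψ j ≟ i)
  ...   | yes (j , ψj≡i) = cong s (ψ-injective (trans ψj≡i (sym ψb≡i)))
  ...   | no ∄j = ⊥-elim (∄j (b , ψb≡i))

  inIm-ψ : ∀ {b i} → ψ b ≡ i → inIm i ≡ false
  inIm-ψ {b} {i} ψb≡i with any? (λ j → φ j ≟ i)
  ... | yes (j , φj≡i) = ⊥-elim (disjoint j b (trans φj≡i (sym ψb≡i)))
  ... | no _ = refl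

  h-positive : Pos r → Pos s → Pos h
  h-positive Pr Ps i with cover i
  ... | inj₁ (a , φa≡i) = subst (1 ≤_) (sym (h-φ φa≡i)) (Pr a)
  ... | inj₂ (b , ψb≡i) = subst (1 ≤_) (sym (h-ψ ψb≡i)) (Ps b)

h-agree : ∀ {k ℓ n} {φ : Fin k → Fin n} {ψ : Fin ℓ → Fin n} → Shuffle φ ψ →
  ∀ (r r' : Vec' k) (s s' : Vec' ℓ) (t t' : Vec' n) i →
  (∀ {a} → φ a ≡ i → r' a ≡ r a) → (∀ {b} → ψ b ≡ i → s' b ≡ s b) →
  Coeff.h r' s' t' φ ψ i ≡ Coeff.h r s t φ ψ i
h-agree sh r r' s s' t t' i r'≡r s'≡s with Shuffle.cover sh i
... | inj₁ (a , φa≡i) =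
  trans (Labels.h-φ r' s' t' sh φa≡i) (trans (r'≡r φa≡i) (sym (Labels.h-φ r s t sh φa≡i)))
... | inj₂ (b , ψb≡i) =
  trans (Labels.h-ψ r' s' t' sh ψb≡i) (trans (s'≡s ψb≡i) (sym (Labels.h-ψ r s t sh ψb≡i)))

module _ {k ℓ n} (r : Vec' k) (s : Vec' ℓ) (t : Vec' n)
         {φ : Fin k → Fin n} {ψ : Fin ℓ → Fin n} (sh : Shuffle φ ψ) where
  private
    module L  = Labels r s t sh
    module L˘ = Labels s r t (Shuffle-swap sh)
    open Coeff r s t φ ψ using (h; inIm)

    h-swap : ∀ i → Coeff.h s r t ψ φ i ≡ h i
    h-swap i with Shuffle.cover sh i
    ... | inj₁ (a , φa≡i) = trans (L˘.h-ψ φa≡i) (sym (L.h-φ φa≡i))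
    ... | inj₂ (b , ψb≡i) = trans (L˘.h-φ ψb≡i) (sym (L.h-ψ ψb≡i))

    inIm-swap : ∀ i → Coeff.inIm s r t ψ φ i ≡ not (inIm i)
    inIm-swap i with Shuffle.cover sh i
    ... | inj₁ (a , φa≡i) rewrite L.inIm-φ φa≡i = L˘.inIm-ψ φa≡i
    ... | inj₂ (b , ψb≡i) rewrite L.inIm-ψ ψb≡i = L˘.inIm-φ ψb≡i

  coeff-swap : Pos r → Pos s → Pos t → c r s t φ ψ ≡ c s r t ψ φ
  coeff-swap Pr Ps Pt = begin
    c r s t φ ψ                                      ≡⟨ coeff≡coeffFrom r s t φ ψ Pt (L.h-positive Pr Ps) true ⟩
    coeffFrom (+ 0) true t h inIm                    ≡⟨ coeffFrom-not (+ 0) true t h inIm ⟨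
    coeffFrom (+ 0) false t h (not ∘ inIm)           ≡⟨ coeffFrom-cong (+ 0) false (λ _ → refl) (sym ∘ h-swap) (sym ∘ inIm-swap) ⟩
    coeffFrom (+ 0) false t (Coeff.h s r t ψ φ) (Coeff.inIm s r t ψ φ)
                                                     ≡⟨ coeff≡coeffFrom s r t ψ φ Pt (L˘.h-positive Ps Pr) false ⟨
    c s r t ψ φ                                      ∎
    where open ≡-Reasoning

module HeadRemoval {k ℓ m} (r : Vec' (suc k)) (s : Vec' ℓ) (t : Vec' (suc m))
                   {φ : Fin (suc k) → Fin (suc m)} {ψ : Fin ℓ → Fin (suc m)}
                   {φ' : Fin k → Fin m} {ψ' : Fin ℓ → Fin m}
                   (sh : Shuffle φ ψ) (φ0 : φ zero ≡ zero) (check : IsCheck φ φ') (bar : IsBar ψ ψ') where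
  open Shuffle sh

  φ-suc : ∀ a → φ (suc a) ≡ suc (φ' a)
  φ-suc a = toℕ-injective (sym (check a))

  ψ-suc : ∀ b → ψ b ≡ suc (ψ' b)
  ψ-suc b = toℕ-injective (sym (bar b))

  shuffle : Shuffle φ' ψ'
  shuffle = record
    { φ-mono   = λ a b a<b → s<s⁻¹ (subst₂ _<_ (sym (check a)) (sym (check b)) (φ-mono (suc a) (suc b) (s<s a<b)))
    ; ψ-mono   = λ a b a<b → s<s⁻¹ (subst₂ _<_ (sym (bar a)) (sym (bar b)) (ψ-mono a b a<b))
    ; disjoint = λ a b eq → disjoint (suc a) b (trans (φ-suc a) (trans (cong suc eq) (sym (ψ-suc b))))
    ; cover    = cover′
    }
    where
    cover′ : ∀ j → (∃ λ a → φ' a ≡ j) ⊎ (∃ λ b → ψ' b ≡ j)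
    cover′ j with cover (suc j)
    ... | inj₁ (zero  , eq) = ⊥-elim (0≢1+n (trans (sym φ0) eq))
    ... | inj₁ (suc a , eq) = inj₁ (a , suc-injective (trans (sym (φ-suc a)) eq))
    ... | inj₂ (b , eq)     = inj₂ (b , suc-injective (trans (sym (ψ-suc b)) eq))

  private
    module L  = Labels r s t sh
    module L′ = Labels (tail' r) s (tail' t) shuffle

  h-tail : ∀ j → Coeff.h (tail' r) s (tail' t) φ' ψ' j ≡ Coeff.h r s t φ ψ (suc j)
  h-tail j with Shuffle.cover shuffle j
  ... | inj₁ (a , refl) = trans (L′.h-φ refl) (sym (L.h-φ (φ-suc a)))
  ... | inj₂ (b , refl) = trans (L′.h-ψ refl) (sym (L.h-ψ (ψ-suc b)))

  inIm-tail : ∀ j → Coeff.inIm (tail' r) s (tail' t) φ' ψ' j ≡ Coeff.inIm r s t φ ψ (suc j)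
  inIm-tail j with Shuffle.cover shuffle j
  ... | inj₁ (a , refl) = trans (L′.inIm-φ refl) (sym (L.inIm-φ (φ-suc a)))
  ... | inj₂ (b , refl) = trans (L′.inIm-ψ refl) (sym (L.inIm-ψ (ψ-suc b)))

minusE1-pos : ∀ {m} {v : Vec' (suc m)} → Pos v → 2 ≤ v zero → Pos (minusE1 v)
minusE1-pos Pv v≥2 zero    = ∸-monoˡ-≤ 1 v≥2
minusE1-pos Pv v≥2 (suc i) = Pv (suc i)

module φ-First {k' ℓ' m} (r : Vec' (suc k')) (s : Vec' (suc ℓ')) (t : Vec' (suc m))
               {φ : Fin (suc k') → Fin (suc m)} {ψ : Fin (suc ℓ') → Fin (suc m)} (sh : Shuffle φ ψ)
               (Pr : Pos r) (Ps : Pos s) (Pt : Pos t) (φ0 : φ zero ≡ zero) where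
  open Shuffle sh
  open Coeff r s t φ ψ using (h; inIm)
  private
    module L = Labels r s t sh

  T H : Vec' m
  T = tail' t
  H = tail' h

  E : Fin m → Bool
  E = inIm ∘ suc

  unfold : ∀ (r' : Vec' (suc k')) (s' : Vec' (suc ℓ')) (t' : Vec' (suc m)) {H' : Vec' m} →
    (∀ i → Coeff.h r' s' t' φ ψ (suc i) ≡ H' i) →
    c r' s' t' φ ψ ≡ sameBinom (t' zero) (r' zero) * coeffFrom (advance (+ 0) (t' zero) (r' zero)) true (tail' t') H' E
  unfold r' s' t' {H'} h′≗H' = begin
    c r' s' t' φ ψ
      ≡⟨ coeff-unfold r' s' t' φ ψ ⟩
    sameBinom (t' zero) (h′ zero) * coeffFrom (advance (+ 0) (t' zero) (h′ zero)) (inIm zero) (tail' t') (tail' h′) E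
      ≡⟨ cong₂ (λ x e → sameBinom (t' zero) x * coeffFrom (advance (+ 0) (t' zero) x) e (tail' t') (tail' h′) E)
               (L′.h-φ φ0) (L.inIm-φ φ0) ⟩
    sameBinom (t' zero) (r' zero) * coeffFrom (advance (+ 0) (t' zero) (r' zero)) true (tail' t') (tail' h′) E
      ≡⟨ cong (sameBinom (t' zero) (r' zero) *_) (coeffFrom-cong _ true (λ _ → refl) h′≗H' (λ _ → refl)) ⟩
    sameBinom (t' zero) (r' zero) * coeffFrom (advance (+ 0) (t' zero) (r' zero)) true (tail' t') H' E
      ∎
    where
    open ≡-Reasoning
    module L′ = Labels r' s' t' sh
    h′ : Vec' (suc m)
    h′ = Coeff.h r' s' t' φ ψ

  ψ-position : ∃ λ p → ψ zero ≡ suc p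
  ψ-position with ψ zero in eq
  ... | zero  = ⊥-elim (disjoint zero zero (trans φ0 (sym eq)))
  ... | suc p = p , refl

  p : Fin m
  p = proj₁ ψ-position

  ψ0≡sp : ψ zero ≡ suc p
  ψ0≡sp = proj₂ ψ-position

  E-before : ∀ i → toℕ i < toℕ p → E i ≡ true
  E-before i i<p with cover (suc i)
  ... | inj₁ (a , eq)     = L.inIm-φ eq
  ... | inj₂ (zero , eq)  = ⊥-elim (<-irrefl (cong toℕ (suc-injective (trans (sym eq) ψ0≡sp))) i<p)
  ... | inj₂ (suc b , eq) =
    ⊥-elim (<-asym (s<s i<p) (subst₂ (λ x y → toℕ x < toℕ y) ψ0≡sp eq (ψ-mono zero (suc b) z<s)))

  E-at : E p ≡ false
  E-at = L.inIm-ψ ψ0≡sp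

  H-at : H p ≡ s zero
  H-at = L.h-ψ ψ0≡sp

  rest : ℕ
  rest = coeffFrom (advance (+ 0) (t zero) (r zero)) true T H E

  coeff-base : c r s t φ ψ ≡ sameBinom (t zero) (r zero) * rest
  coeff-base = unfold r s t (λ _ → refl)

  coeff-minusE1-r : c (minusE1 r) s (minusE1 t) φ ψ ≡ sameBinom (t zero ∸ 1) (r zero ∸ 1) * rest
  coeff-minusE1-r = trans (unfold (minusE1 r) s (minusE1 t) agree)
    (cong (λ d → sameBinom (t zero ∸ 1) (r zero ∸ 1) * coeffFrom d true T H E)
          (advance-pred-pred (+ 0) (Pt zero) (Pr zero)))
    where
    agree : ∀ i → Coeff.h (minusE1 r) s (minusE1 t) φ ψ (suc i) ≡ H i
    agree i = h-agree sh r (minusE1 r) s s t (minusE1 t) (suc i)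
      (λ { {zero} eq → ⊥-elim (0≢1+n (trans (sym φ0) eq)) ; {suc a} _ → refl }) (λ _ → refl)

  coeff-minusE1-s : c r (minusE1 s) (minusE1 t) φ ψ ≡ sameBinom (t zero ∸ 1) (r zero) * rest
  coeff-minusE1-s = trans (unfold r (minusE1 s) (minusE1 t) (λ _ → refl))
    (cong (sameBinom (t zero ∸ 1) (r zero) *_)
      (trans (cong (λ d → coeffFrom d true T H₂ E) (advance-predˡ (+ 0) (r zero) (Pt zero)))
             (coeffFrom-lower _ true T H H₂ E p E-before E-at H-at≡suc agree)))
    where
    H₂ : Vec' m
    H₂ = tail' (Coeff.h r (minusE1 s) (minusE1 t) φ ψ)
    H-at≡suc : H p ≡ suc (H₂ p)
    H-at≡suc = trans H-at (trans (sym (suc-pred (s zero) {{>-nonZero (Ps zero)}}))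
      (cong suc (sym (Labels.h-ψ r (minusE1 s) (minusE1 t) sh ψ0≡sp))))
    agree : ∀ i → i ≢ p → H₂ i ≡ H i
    agree i i≢p = h-agree sh r r s (minusE1 s) t (minusE1 t) (suc i) (λ _ → refl)
      (λ { {zero} eq → ⊥-elim (i≢p (suc-injective (trans (sym eq) ψ0≡sp))) ; {suc b} _ → refl })

  rest-vanish : s zero ≡ 1 → r zero < t zero → rest ≡ 0
  rest-vanish s1 r<t = trans (cong (λ d → coeffFrom d true T H E) (advance-nonneg 0 (<⇒≤ r<t)))
    (coeffFrom-vanish true T H E p (m<n⇒0<n∸m r<t) (Pt ∘ suc) E-before E-at (trans H-at s1))

  coeff-minusE1-s-vanish : s zero ≡ 1 → 2 ≤ t zero → c r (minusE1 s) (minusE1 t) φ ψ ≡ 0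
  coeff-minusE1-s-vanish s1 t2 with r zero <? t zero
  ... | yes r<t = trans coeff-minusE1-s
                    (trans (cong (sameBinom (t zero ∸ 1) (r zero) *_) (rest-vanish s1 r<t))
                           (*-zeroʳ (sameBinom (t zero ∸ 1) (r zero))))
  ... | no r≮t  = trans coeff-minusE1-s (cong (_* rest) (sameBinom-pred-vanish t2 (≮⇒≥ r≮t)))

  pascal : 2 ≤ r zero → 2 ≤ t zero →
    c r s t φ ψ ≡ c (minusE1 r) s (minusE1 t) φ ψ + c r (minusE1 s) (minusE1 t) φ ψ
  pascal r2 t2 = begin
    c r s t φ ψ                                                          ≡⟨ coeff-base ⟩
    sameBinom (t zero) (r zero) * rest                                   ≡⟨ cong (_* rest) (sameBinom-pascal t2 r2) ⟩
    (sameBinom (t zero ∸ 1) (r zero ∸ 1) + sameBinom (t zero ∸ 1) (r zero)) * rest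
                                                                         ≡⟨ *-distribʳ-+ rest (sameBinom (t zero ∸ 1) (r zero ∸ 1)) (sameBinom (t zero ∸ 1) (r zero)) ⟩
    sameBinom (t zero ∸ 1) (r zero ∸ 1) * rest + sameBinom (t zero ∸ 1) (r zero) * rest
                                                                         ≡⟨ cong₂ _+_ coeff-minusE1-r coeff-minusE1-s ⟨
    c (minusE1 r) s (minusE1 t) φ ψ + c r (minusE1 s) (minusE1 t) φ ψ    ∎
    where open ≡-Reasoning

  vanish-t1 : t zero ≡ 1 → 2 ≤ r zero → c r s t φ ψ ≡ 0
  vanish-t1 t1 r2 = trans coeff-base
    (cong (_* rest) (trans (cong (λ a → sameBinom a (r zero)) t1) (sameBinom-pred-vanish ≤-refl r2)))

  drop-s : r zero ≡ 1 → c r s t φ ψ ≡ c r (minusE1 s) (minusE1 t) φ ψ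
  drop-s r1 = trans coeff-base (trans (cong (_* rest) same) (sym coeff-minusE1-s))
    where
    same : sameBinom (t zero) (r zero) ≡ sameBinom (t zero ∸ 1) (r zero)
    same = trans (cong (sameBinom (t zero)) r1) (sym (cong (sameBinom (t zero ∸ 1)) r1))

  vanish-t2 : r zero ≡ 1 → s zero ≡ 1 → 2 ≤ t zero → c r s t φ ψ ≡ 0
  vanish-t2 r1 s1 t2 = trans coeff-base
    (trans (cong (sameBinom (t zero) (r zero) *_) (rest-vanish s1 (subst (_< t zero) (sym r1) t2)))
           (*-zeroʳ (sameBinom (t zero) (r zero))))

  drop-r : s zero ≡ 1 → 2 ≤ r zero → 2 ≤ t zero → c r s t φ ψ ≡ c (minusE1 r) s (minusE1 t) φ ψ
  drop-r s1 r2 t2 = trans (pascal r2 t2)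
    (trans (cong (_+_ (c (minusE1 r) s (minusE1 t) φ ψ)) (coeff-minusE1-s-vanish s1 t2)) (+-identityʳ _))

  drop-head : r zero ≡ 1 → t zero ≡ 1 → (φ' : Fin k' → Fin m) (ψ' : Fin (suc ℓ') → Fin m) →
    IsCheck φ φ' → IsBar ψ ψ' → c r s t φ ψ ≡ c (tail' r) s (tail' t) φ' ψ'
  drop-head r1 t1 φ' ψ' check bar = begin
    c r s t φ ψ                                  ≡⟨ coeff-base ⟩
    sameBinom (t zero) (r zero) * rest           ≡⟨ cong₂ (λ a x → sameBinom a x * coeffFrom (advance (+ 0) a x) true T H E) t1 r1 ⟩
    1 * coeffFrom (+ 0) true T H E               ≡⟨ *-identityˡ _ ⟩
    coeffFrom (+ 0) true T H E                   ≡⟨ coeffFrom-cong (+ 0) true (λ _ → refl) (sym ∘ h-tail) (sym ∘ inIm-tail) ⟩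
    coeffFrom (+ 0) true T (Coeff.h (tail' r) s (tail' t) φ' ψ') (Coeff.inIm (tail' r) s (tail' t) φ' ψ')
                                                 ≡⟨ coeff≡coeffFrom (tail' r) s (tail' t) φ' ψ' (Pt ∘ suc) positive true ⟨
    c (tail' r) s (tail' t) φ' ψ'                ∎
    where
    open ≡-Reasoning
    open HeadRemoval r s t sh φ0 check bar
    positive : Pos (Coeff.h (tail' r) s (tail' t) φ' ψ')
    positive = Labels.h-positive (tail' r) s (tail' t) shuffle (Pr ∘ suc) Ps

module Recurrences {k' ℓ' m} (r : Vec' (suc k')) (s : Vec' (suc ℓ')) (t : Vec' (suc m))
                {φ : Fin (suc k') → Fin (suc m)} {ψ : Fin (suc ℓ') → Fin (suc m)} (sh : Shuffle φ ψ)
                (Pr : Pos r) (Ps : Pos s) (Pt : Pos t) where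
  module Φ = φ-First r s t sh Pr Ps Pt
  module Ψ = φ-First s r t (Shuffle-swap sh) Ps Pr Pt

  swapped : c r s t φ ψ ≡ c s r t ψ φ
  swapped = coeff-swap r s t sh Pr Ps Pt

  pascal : 2 ≤ r zero → 2 ≤ s zero → 2 ≤ t zero →
    c r s t φ ψ ≡ c (minusE1 r) s (minusE1 t) φ ψ + c r (minusE1 s) (minusE1 t) φ ψ
  pascal r2 s2 t2 with first-position sh
  ... | inj₁ φ0 = Φ.pascal φ0 r2 t2
  ... | inj₂ ψ0 = begin
    c r s t φ ψ                                                          ≡⟨ swapped ⟩
    c s r t ψ φ                                                          ≡⟨ Ψ.pascal ψ0 s2 t2 ⟩
    c (minusE1 s) r (minusE1 t) ψ φ + c s (minusE1 r) (minusE1 t) ψ φ    ≡⟨ +-comm (c (minusE1 s) r (minusE1 t) ψ φ) (c s (minusE1 r) (minusE1 t) ψ φ) ⟩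
    c s (minusE1 r) (minusE1 t) ψ φ + c (minusE1 s) r (minusE1 t) ψ φ
      ≡⟨ cong₂ _+_ (coeff-swap (minusE1 r) s (minusE1 t) sh (minusE1-pos Pr r2) Ps (minusE1-pos Pt t2))
                   (coeff-swap r (minusE1 s) (minusE1 t) sh Pr (minusE1-pos Ps s2) (minusE1-pos Pt t2)) ⟨
    c (minusE1 r) s (minusE1 t) φ ψ + c r (minusE1 s) (minusE1 t) φ ψ    ∎
    where open ≡-Reasoning

  vanish-t1-ψ : ψ zero ≡ zero → t zero ≡ 1 → 2 ≤ s zero → c r s t φ ψ ≡ 0
  vanish-t1-ψ ψ0 t1 s2 = trans swapped (Ψ.vanish-t1 ψ0 t1 s2)

  vanish-t1 : t zero ≡ 1 → 2 ≤ r zero → 2 ≤ s zero → c r s t φ ψ ≡ 0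
  vanish-t1 t1 r2 s2 with first-position sh
  ... | inj₁ φ0 = Φ.vanish-t1 φ0 t1 r2
  ... | inj₂ ψ0 = vanish-t1-ψ ψ0 t1 s2

  vanish-t2 : r zero ≡ 1 → s zero ≡ 1 → 2 ≤ t zero → c r s t φ ψ ≡ 0
  vanish-t2 r1 s1 t2 with first-position sh
  ... | inj₁ φ0 = Φ.vanish-t2 φ0 r1 s1 t2
  ... | inj₂ ψ0 = trans swapped (Ψ.vanish-t2 ψ0 s1 r1 t2)

  drop-s : r zero ≡ 1 → 2 ≤ s zero → 2 ≤ t zero → c r s t φ ψ ≡ c r (minusE1 s) (minusE1 t) φ ψ
  drop-s r1 s2 t2 with first-position sh
  ... | inj₁ φ0 = Φ.drop-s φ0 r1
  ... | inj₂ ψ0 = trans swapped (trans (Ψ.drop-r ψ0 r1 s2 t2)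
    (sym (coeff-swap r (minusE1 s) (minusE1 t) sh Pr (minusE1-pos Ps s2) (minusE1-pos Pt t2))))

  drop-r : 2 ≤ r zero → s zero ≡ 1 → 2 ≤ t zero → c r s t φ ψ ≡ c (minusE1 r) s (minusE1 t) φ ψ
  drop-r r2 s1 t2 with first-position sh
  ... | inj₁ φ0 = Φ.drop-r φ0 s1 r2 t2
  ... | inj₂ ψ0 = trans swapped (trans (Ψ.drop-s ψ0 s1)
    (sym (coeff-swap (minusE1 r) s (minusE1 t) sh (minusE1-pos Pr r2) Ps (minusE1-pos Pt t2))))

  drop-head-ψ : ψ zero ≡ zero → s zero ≡ 1 → t zero ≡ 1 →
    (φ' : Fin (suc k') → Fin m) (ψ' : Fin ℓ' → Fin m) →
    IsBar φ φ' → IsCheck ψ ψ' → c r s t φ ψ ≡ c r (tail' s) (tail' t) φ' ψ'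
  drop-head-ψ ψ0 s1 t1 φ' ψ' bar check = trans swapped (trans (Ψ.drop-head ψ0 s1 t1 ψ' φ' check bar)
    (coeff-swap (tail' s) r (tail' t) (HeadRemoval.shuffle s r t (Shuffle-swap sh) ψ0 check bar) (Ps ∘ suc) Pr (Pt ∘ suc)))

lemma3p6 : (k' ℓ' : ℕ) (r : Vec' (suc k')) (s : Vec' (suc ℓ')) (t : Vec' (suc k' + suc ℓ'))
    (φ : Fin (suc k') → Fin (suc k' + suc ℓ')) (ψ : Fin (suc ℓ') → Fin (suc k' + suc ℓ')) →
    Pos r → Pos s → Pos t → vsum r + vsum s ≡ vsum t → IsShuffle φ ψ →
    -- (1)
    (2 ≤ r zero → 2 ≤ s zero →
      (2 ≤ t zero → c r s t φ ψ ≡ c (minusE1 r) s (minusE1 t) φ ψ + c r (minusE1 s) (minusE1 t) φ ψ)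
      × (t zero ≡ 1 → c r s t φ ψ ≡ 0))
    -- (2)
    × (r zero ≡ 1 → s zero ≡ 1 →
      (φ zero ≡ zero → t zero ≡ 1 →
        (φˇ : Fin k' → Fin (k' + suc ℓ')) (ψ¯ : Fin (suc ℓ') → Fin (k' + suc ℓ')) →
        IsCheck φ φˇ → IsBar ψ ψ¯ → c r s t φ ψ ≡ c (tail' r) s (tail' t) φˇ ψ¯)
      × (ψ zero ≡ zero → t zero ≡ 1 →
        (φ¯ : Fin (suc k') → Fin (k' + suc ℓ')) (ψˇ : Fin ℓ' → Fin (k' + suc ℓ')) →
        IsBar φ φ¯ → IsCheck ψ ψˇ → c r s t φ ψ ≡ c r (tail' s) (tail' t) φ¯ ψˇ)
      × (2 ≤ t zero → c r s t φ ψ ≡ 0))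
    -- (3)
    × (r zero ≡ 1 → 2 ≤ s zero →
      (φ zero ≡ zero → t zero ≡ 1 →
        (φˇ : Fin k' → Fin (k' + suc ℓ')) (ψ¯ : Fin (suc ℓ') → Fin (k' + suc ℓ')) →
        IsCheck φ φˇ → IsBar ψ ψ¯ → c r s t φ ψ ≡ c (tail' r) s (tail' t) φˇ ψ¯)
      × (ψ zero ≡ zero → t zero ≡ 1 → c r s t φ ψ ≡ 0)
      × (2 ≤ t zero → c r s t φ ψ ≡ c r (minusE1 s) (minusE1 t) φ ψ))
    -- (3, symmetric)
    × (2 ≤ r zero → s zero ≡ 1 →
      (ψ zero ≡ zero → t zero ≡ 1 →
        (φ¯ : Fin (suc k') → Fin (k' + suc ℓ')) (ψˇ : Fin ℓ' → Fin (k' + suc ℓ')) →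
        IsBar φ φ¯ → IsCheck ψ ψˇ → c r s t φ ψ ≡ c r (tail' s) (tail' t) φ¯ ψˇ)
      × (φ zero ≡ zero → t zero ≡ 1 → c r s t φ ψ ≡ 0)
      × (2 ≤ t zero → c r s t φ ψ ≡ c (minusE1 r) s (minusE1 t) φ ψ))
lemma3p6 k' ℓ' r s t φ ψ Pr Ps Pt _ shuffle =
    (λ r2 s2 → pascal r2 s2 , λ t1 → vanish-t1 t1 r2 s2)
  , (λ r1 s1 → (λ φ0 t1 → Φ.drop-head φ0 r1 t1) , (λ ψ0 t1 → drop-head-ψ ψ0 s1 t1) , vanish-t2 r1 s1)
  , (λ r1 s2 → (λ φ0 t1 → Φ.drop-head φ0 r1 t1) , (λ ψ0 t1 → vanish-t1-ψ ψ0 t1 s2) , drop-s r1 s2)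
  , (λ r2 s1 → (λ ψ0 t1 → drop-head-ψ ψ0 s1 t1) , (λ φ0 t1 → Φ.vanish-t1 φ0 t1 r2) , drop-r r2 s1)
  where
  open Recurrences r s t (IsShuffle⇒Shuffle shuffle) Pr Ps Pt
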